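{- Let $r,n,t$ be positive integers with $t\le n$. Let $Y$ be a $t$-design in $S_n$ and let $D$ be an orthogonal array of strength $t$ in $H(n,r)$. Then $\{(g,y):g\in D,\ y\in Y\}$ is a $t$-design in $C_r\wr S_n$.
   Context: $C_r=\mathbb{Z}/r\mathbb{Z}$; $[n]=\{1,\dots,n\}$. $C_r\wr S_n$ consists of pairs $(g,\pi)$, $g\in C_r^n$, $\pi\in S_n$, with $(f,\pi)(g,\sigma)=(f+g^\pi,\pi\sigma)$, $g^\pi=(g_{\pi^{ -1}(1)},\dots,g_{\pi^{ -1}(n)})$, acting on $C_r\times[n]$ by $(g,\pi)\cdot(c,i)=(c+g_{\pi(i)},\pi(i))$. A nonempty subset of $C_r\wr S_n$ is a $t$-design if there is $c>0$ such that for any two $t$-tuples $((c_1,i_1),\dots,(c_t,i_t))$ and $((c'_1,i'_1),\dots,(c'_t,i'_t))$ of elements of $C_r\times[n]$, each with pairwise distinct second coordinates, exactly $c$ of its elements map the first tuple to the second componentwise. A $t$-design in $S_n$ is a nonempty subset $Y\subseteq S_n$ such that for any two ordered $t$-tuples of distinct elements of $[n]$ a constant positive number of elements of $Y$ map the first to the second. An orthogonal array of strength $t$ in $H(n,r)$ is a nonempty subset $D\subseteq C_r^n$ such that for any $t$ coordinate positions, the restriction of $D$ to these positions contains every element of $C_r^t$ exactly $|D|/r^t$ times. -}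

module Defs where

open import Data.Nat using (ℕ; zero; suc; _+_; _*_; _^_; _≤_; _<_; NonZero)
open import Data.Nat.DivMod using (_mod_)
open import Data.Fin using (Fin; toℕ)
open import Data.Fin.Properties using (all?) renaming (_≟_ to _≟ᶠ_)
open import Data.Fin.Permutation using (Permutation′; _⟨$⟩ʳ_)
open import Data.Product using (_×_; _,_; proj₁; proj₂; Σ; ∃)
open import Data.Product.Properties using (≡-dec)
open import Data.List using (List; length; filter; cartesianProduct)
open import Data.List.Relation.Unary.AllPairs using (AllPairs)
open import Function.Definitions using (Injective)
open import Relation.Binary.PropositionalEquality using (_≡_)
open import Relation.Nullary using (¬_)
open import Relation.Unary using (Decidable)

C : ℕ → Set
C r = Fin r

_⊕_ : {r : ℕ} .{{_ : NonZero r}} → C r → C r → C r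
_⊕_ {r} a b = (toℕ a + toℕ b) mod r

Sym : ℕ → Set
Sym n = Permutation′ n

Word : ℕ → ℕ → Set
Word n r = Fin n → C r

Wreath : ℕ → ℕ → Set
Wreath r n = Word n r × Sym n

act : {r n : ℕ} .{{_ : NonZero r}} → Wreath r n → C r × Fin n → C r × Fin n
act (g , π) (c , i) = (c ⊕ g (π ⟨$⟩ʳ i)) , (π ⟨$⟩ʳ i)

-- Finite subsets are represented by lists whose entries are pairwise distinct
-- (distinctness is extensional: as functions / pairs of functions).
DistinctSym : {n : ℕ} → List (Sym n) → Set
DistinctSym = AllPairs (λ σ τ → ¬ (∀ i → σ ⟨$⟩ʳ i ≡ τ ⟨$⟩ʳ i))

DistinctWord : {n r : ℕ} → List (Word n r) → Set
DistinctWord = AllPairs (λ g h → ¬ (∀ i → g i ≡ h i))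

DistinctWreath : {r n : ℕ} → List (Wreath r n) → Set
DistinctWreath = AllPairs (λ x y →
  ¬ ((∀ i → proj₁ x i ≡ proj₁ y i) × (∀ i → proj₂ x ⟨$⟩ʳ i ≡ proj₂ y ⟨$⟩ʳ i)))

count : {A : Set} {P : A → Set} → Decidable P → List A → ℕ
count P? xs = length (filter P? xs)

MapsSym : {n t : ℕ} → (Fin t → Fin n) → (Fin t → Fin n) → Sym n → Set
MapsSym a b σ = ∀ k → σ ⟨$⟩ʳ a k ≡ b k

mapsSym? : {n t : ℕ} (a b : Fin t → Fin n) → Decidable (MapsSym a b)
mapsSym? a b σ = all? (λ k → (σ ⟨$⟩ʳ a k) ≟ᶠ b k)

IsSymDesign : (n t : ℕ) → List (Sym n) → Set
IsSymDesign n t Y =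
  DistinctSym Y × 0 < length Y ×
  Σ ℕ (λ c → 0 < c ×
    ((a b : Fin t → Fin n) → Injective _≡_ _≡_ a → Injective _≡_ _≡_ b →
      count (mapsSym? a b) Y ≡ c))

-- Orthogonal array of strength t in H(n,r): nonempty D such that for any t
-- (distinct) coordinate positions, every w ∈ C_r^t occurs exactly |D|/r^t
-- times in the restriction (stated as  count * r^t = |D|).
RestrictsTo : {n r t : ℕ} → (Fin t → Fin n) → (Fin t → C r) → Word n r → Set
RestrictsTo pos w g = ∀ k → g (pos k) ≡ w k

restrictsTo? : {n r t : ℕ} (pos : Fin t → Fin n) (w : Fin t → C r) → Decidable (RestrictsTo pos w)
restrictsTo? pos w g = all? (λ k → g (pos k) ≟ᶠ w k)

IsOrthogonalArray : (n r t : ℕ) → List (Word n r) → Set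
IsOrthogonalArray n r t D =
  DistinctWord D × 0 < length D ×
  ((pos : Fin t → Fin n) → Injective _≡_ _≡_ pos → (w : Fin t → C r) →
     count (restrictsTo? pos w) D * r ^ t ≡ length D)

MapsWreath : {r n t : ℕ} .{{_ : NonZero r}} →
  (Fin t → C r × Fin n) → (Fin t → C r × Fin n) → Wreath r n → Set
MapsWreath a b x = ∀ k → act x (a k) ≡ b k

mapsWreath? : {r n t : ℕ} .{{_ : NonZero r}} (a b : Fin t → C r × Fin n) →
  Decidable (MapsWreath a b)
mapsWreath? a b x = all? (λ k → ≡-dec _≟ᶠ_ _≟ᶠ_ (act x (a k)) (b k))

IsWreathDesign : (r n t : ℕ) .{{_ : NonZero r}} → List (Wreath r n) → Set
IsWreathDesign r n t X =
  DistinctWreath X × 0 < length X ×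
  Σ ℕ (λ c → 0 < c ×
    ((a b : Fin t → C r × Fin n) →
      Injective _≡_ _≡_ (λ k → proj₂ (a k)) → Injective _≡_ _≡_ (λ k → proj₂ (b k)) →
      count (mapsWreath? a b) X ≡ c))

prodSet : {r n : ℕ} → List (Word n r) → List (Sym n) → List (Wreath r n)
prodSet D Y = cartesianProduct D Y

{-# OPTIONS --safe #-}
module Submission where

-- An element (g , π) of C_r ≀ S_n maps (c_k , i_k) to (c′_k , i′_k) for all k exactly when
-- π maps each i_k to i′_k and g takes the value c′_k − c_k at position i′_k. The two
-- conditions are independent, so among the pairs (g , y) ∈ D × Y the number of such
-- elements is the number of y ∈ Y moving the i_k to the i′_k, which is the index of Y,
-- times the number of g ∈ D with prescribed values at t distinct positions, which is |D|/r^t.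

open import Defs
open import Algebra.Properties.CommutativeSemigroup using (x∙yz≈y∙xz; xy∙z≈y∙xz)
open import Data.Nat using (ℕ; suc; _+_; _*_; _∸_; _^_; _≤_; _<_; NonZero; >-nonZero; >-nonZero⁻¹)
open import Data.Nat.Properties
  using (+-commutativeSemigroup; +-comm; m+[n∸m]≡n; <⇒≤; m^n≢0; m*n≢0⇒m≢0; *-mono-<)
open import Data.Nat.DivMod
  using (_%_; _/_; _mod_; %-distribˡ-+; m%n%n≡m%n; [m+n]%n≡m%n; m<n⇒m%n≡m; m*n/n≡m)
open import Data.Bool using (true; false)
open import Data.Fin using (Fin; toℕ; inject≤)
open import Data.Fin.Permutation using (_⟨$⟩ʳ_)
open import Data.Fin.Properties using (toℕ-fromℕ<; toℕ-injective; toℕ<n; inject≤-injective)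
open import Data.List using (List; []; _∷_; _++_; map; filter; length; cartesianProduct)
open import Data.List.Properties using (filter-++; filter-≐; filter-none; length-++; length-map)
open import Data.List.Relation.Unary.All using (universal)
open import Data.List.Relation.Unary.All.Properties using (map⁺)
open import Data.List.Relation.Unary.Unique.Setoid.Properties using (cartesianProduct⁺)
open import Data.Product using (_×_; _,_; proj₁; proj₂)
open import Function using (_∘_)
open import Function.Definitions using (Injective)
open import Relation.Binary.PropositionalEquality
  using (_≡_; refl; sym; trans; cong; cong₂; subst; _→-setoid_; module ≡-Reasoning)
import Relation.Binary.Construct.On as On
open import Relation.Nullary using (yes; no; does)
open import Relation.Unary using (Decidable; _⊆_; _≐_; _⟨×⟩_)
open import Relation.Unary.Properties using (_×?_)

module _ {r : ℕ} .{{_ : NonZero r}} where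

  [m+n%r]%r≡[m+n]%r : ∀ m n → (m + n % r) % r ≡ (m + n) % r
  [m+n%r]%r≡[m+n]%r m n = begin
    (m + n % r) % r           ≡⟨ %-distribˡ-+ m (n % r) r ⟩
    (m % r + n % r % r) % r   ≡⟨ cong (λ z → (m % r + z) % r) (m%n%n≡m%n n r) ⟩
    (m % r + n % r) % r       ≡⟨ %-distribˡ-+ m n r ⟨
    (m + n) % r               ∎
    where open ≡-Reasoning

  [m%r+n]%r≡[m+n]%r : ∀ m n → (m % r + n) % r ≡ (m + n) % r
  [m%r+n]%r≡[m+n]%r m n = begin
    (m % r + n) % r   ≡⟨ cong (_% r) (+-comm (m % r) n) ⟩
    (n + m % r) % r   ≡⟨ [m+n%r]%r≡[m+n]%r n m ⟩
    (n + m) % r       ≡⟨ cong (_% r) (+-comm n m) ⟩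
    (m + n) % r       ∎
    where open ≡-Reasoning

  infixl 6 _⊖_

  _⊖_ : C r → C r → C r
  c ⊖ a = (toℕ c + (r ∸ toℕ a)) mod r

  toℕ-⊕ : ∀ (a b : C r) → toℕ (a ⊕ b) ≡ (toℕ a + toℕ b) % r
  toℕ-⊕ a b = toℕ-fromℕ< _

  toℕ-⊖ : ∀ (c a : C r) → toℕ (c ⊖ a) ≡ (toℕ c + (r ∸ toℕ a)) % r
  toℕ-⊖ c a = toℕ-fromℕ< _

  [c+[a+[r∸a]]]%r≡c : ∀ (c a : C r) → (toℕ c + (toℕ a + (r ∸ toℕ a))) % r ≡ toℕ c
  [c+[a+[r∸a]]]%r≡c c a = begin
    (toℕ c + (toℕ a + (r ∸ toℕ a))) % r ≡⟨ cong (λ z → (toℕ c + z) % r) (m+[n∸m]≡n (<⇒≤ (toℕ<n a))) ⟩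
    (toℕ c + r) % r                     ≡⟨ [m+n]%n≡m%n (toℕ c) r ⟩
    toℕ c % r                           ≡⟨ m<n⇒m%n≡m (toℕ<n c) ⟩
    toℕ c                               ∎
    where open ≡-Reasoning

  a⊕[c⊖a]≡c : ∀ (a c : C r) → a ⊕ (c ⊖ a) ≡ c
  a⊕[c⊖a]≡c a c = toℕ-injective (begin
    toℕ (a ⊕ (c ⊖ a))                           ≡⟨ toℕ-⊕ a (c ⊖ a) ⟩
    (toℕ a + toℕ (c ⊖ a)) % r                   ≡⟨ cong (λ z → (toℕ a + z) % r) (toℕ-⊖ c a) ⟩
    (toℕ a + (toℕ c + (r ∸ toℕ a)) % r) % r     ≡⟨ [m+n%r]%r≡[m+n]%r (toℕ a) _ ⟩
    (toℕ a + (toℕ c + (r ∸ toℕ a))) % r         ≡⟨ cong (_% r) (x∙yz≈y∙xz +-commutativeSemigroup (toℕ a) (toℕ c) _) ⟩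
    (toℕ c + (toℕ a + (r ∸ toℕ a))) % r         ≡⟨ [c+[a+[r∸a]]]%r≡c c a ⟩
    toℕ c                                       ∎)
    where open ≡-Reasoning

  [a⊕x]⊖a≡x : ∀ (a x : C r) → (a ⊕ x) ⊖ a ≡ x
  [a⊕x]⊖a≡x a x = toℕ-injective (begin
    toℕ ((a ⊕ x) ⊖ a)                           ≡⟨ toℕ-⊖ (a ⊕ x) a ⟩
    (toℕ (a ⊕ x) + (r ∸ toℕ a)) % r             ≡⟨ cong (λ z → (z + (r ∸ toℕ a)) % r) (toℕ-⊕ a x) ⟩
    ((toℕ a + toℕ x) % r + (r ∸ toℕ a)) % r     ≡⟨ [m%r+n]%r≡[m+n]%r (toℕ a + toℕ x) _ ⟩
    (toℕ a + toℕ x + (r ∸ toℕ a)) % r           ≡⟨ cong (_% r) (xy∙z≈y∙xz +-commutativeSemigroup (toℕ a) (toℕ x) _) ⟩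
    (toℕ x + (toℕ a + (r ∸ toℕ a))) % r         ≡⟨ [c+[a+[r∸a]]]%r≡c x a ⟩
    toℕ x                                       ∎)
    where open ≡-Reasoning

  a⊕x≡c⇒x≡c⊖a : ∀ {a x c : C r} → a ⊕ x ≡ c → x ≡ c ⊖ a
  a⊕x≡c⇒x≡c⊖a {a} {x} a⊕x≡c = trans (sym ([a⊕x]⊖a≡x a x)) (cong (_⊖ a) a⊕x≡c)

module _ {A : Set} where

  count-≐ : ∀ {P Q : A → Set} (P? : Decidable P) (Q? : Decidable Q) →
            P ≐ Q → ∀ xs → count P? xs ≡ count Q? xs
  count-≐ P? Q? P≐Q xs = cong length (filter-≐ P? Q? P≐Q xs)

  count-++ : ∀ {P : A → Set} (P? : Decidable P) xs ys →
             count P? (xs ++ ys) ≡ count P? xs + count P? ys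
  count-++ P? xs ys = trans (cong length (filter-++ P? xs ys)) (length-++ (filter P? xs))

  count-map : ∀ {B : Set} {P : B → Set} (P? : Decidable P) (f : A → B) xs →
              count P? (map f xs) ≡ count (P? ∘ f) xs
  count-map P? f []       = refl
  count-map P? f (x ∷ xs) with does (P? (f x))
  ... | true  = cong suc (count-map P? f xs)
  ... | false = count-map P? f xs

module _ {A B : Set} {P : A → Set} {Q : B → Set} (P? : Decidable P) (Q? : Decidable Q) where

  count-cartesianProduct : ∀ xs ys →
    count (P? ×? Q?) (cartesianProduct xs ys) ≡ count P? xs * count Q? ys
  count-cartesianProduct []       ys = refl
  count-cartesianProduct (x ∷ xs) ys with P? x
  ... | yes px = begin
    count (P? ×? Q?) (map (x ,_) ys ++ cartesianProduct xs ys)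
      ≡⟨ count-++ (P? ×? Q?) (map (x ,_) ys) _ ⟩
    count (P? ×? Q?) (map (x ,_) ys) + count (P? ×? Q?) (cartesianProduct xs ys)
      ≡⟨ cong₂ _+_ row (count-cartesianProduct xs ys) ⟩
    count Q? ys + count P? xs * count Q? ys
      ∎
    where
    open ≡-Reasoning
    row : count (P? ×? Q?) (map (x ,_) ys) ≡ count Q? ys
    row = trans (count-map (P? ×? Q?) (x ,_) ys) (count-≐ _ Q? (proj₂ , (px ,_)) ys)
  ... | no ¬px = trans (count-++ (P? ×? Q?) (map (x ,_) ys) _)
                       (cong₂ _+_ row (count-cartesianProduct xs ys))
    where
    row : count (P? ×? Q?) (map (x ,_) ys) ≡ 0
    row = cong length (filter-none (P? ×? Q?) (map⁺ (universal (λ _ → ¬px ∘ proj₁) ys)))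

-- The distinctness predicates of Defs are Unique with respect to pointwise equality.
prodSet-distinct : ∀ {r n} {D : List (Word n r)} {Y : List (Sym n)} →
                   DistinctWord D → DistinctSym Y → DistinctWreath (prodSet D Y)
prodSet-distinct {r} {n} =
  cartesianProduct⁺ (Fin n →-setoid Fin r) (On.setoid (Fin n →-setoid Fin n) _⟨$⟩ʳ_)

length-cartesianProduct : ∀ {A B : Set} (xs : List A) (ys : List B) →
                          length (cartesianProduct xs ys) ≡ length xs * length ys
length-cartesianProduct []       ys = refl
length-cartesianProduct (x ∷ xs) ys = begin
  length (map (x ,_) ys ++ cartesianProduct xs ys)
    ≡⟨ length-++ (map (x ,_) ys) ⟩
  length (map (x ,_) ys) + length (cartesianProduct xs ys)
    ≡⟨ cong₂ _+_ (length-map (x ,_) ys) (length-cartesianProduct xs ys) ⟩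
  length ys + length xs * length ys
    ∎
  where open ≡-Reasoning

module _ {r n t : ℕ} .{{_ : NonZero r}} where

  shift : (a b : Fin t → C r × Fin n) → Fin t → C r
  shift a b k = proj₁ (b k) ⊖ proj₁ (a k)

  mapsWreath≐ : ∀ (a b : Fin t → C r × Fin n) →
    MapsWreath a b ≐ (RestrictsTo (proj₂ ∘ b) (shift a b) ⟨×⟩ MapsSym (proj₂ ∘ a) (proj₂ ∘ b))
  mapsWreath≐ a b = (λ {x} → to {x}) , (λ {x} → from {x})
    where
    to : MapsWreath a b ⊆ (RestrictsTo (proj₂ ∘ b) (shift a b) ⟨×⟩ MapsSym (proj₂ ∘ a) (proj₂ ∘ b))
    to {g , π} maps = restricts , moves
      where
      moves : MapsSym (proj₂ ∘ a) (proj₂ ∘ b) π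
      moves k = cong proj₂ (maps k)
      restricts : RestrictsTo (proj₂ ∘ b) (shift a b) g
      restricts k = trans (cong g (sym (moves k))) (a⊕x≡c⇒x≡c⊖a (cong proj₁ (maps k)))
    from : (RestrictsTo (proj₂ ∘ b) (shift a b) ⟨×⟩ MapsSym (proj₂ ∘ a) (proj₂ ∘ b)) ⊆ MapsWreath a b
    from {g , π} (restricts , moves) k = cong₂ _,_ colour (moves k)
      where
      open ≡-Reasoning
      colour : proj₁ (a k) ⊕ g (π ⟨$⟩ʳ proj₂ (a k)) ≡ proj₁ (b k)
      colour = begin
        proj₁ (a k) ⊕ g (π ⟨$⟩ʳ proj₂ (a k))  ≡⟨ cong (λ i → proj₁ (a k) ⊕ g i) (moves k) ⟩
        proj₁ (a k) ⊕ g (proj₂ (b k))         ≡⟨ cong (proj₁ (a k) ⊕_) (restricts k) ⟩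
        proj₁ (a k) ⊕ shift a b k             ≡⟨ a⊕[c⊖a]≡c (proj₁ (a k)) (proj₁ (b k)) ⟩
        proj₁ (b k)                           ∎

  count-mapsWreath : ∀ (a b : Fin t → C r × Fin n) D Y →
    count (mapsWreath? a b) (prodSet D Y) ≡
      count (restrictsTo? (proj₂ ∘ b) (shift a b)) D * count (mapsSym? (proj₂ ∘ a) (proj₂ ∘ b)) Y
  count-mapsWreath a b D Y =
    trans (count-≐ (mapsWreath? a b) (restrictsTo? _ _ ×? mapsSym? _ _) (mapsWreath≐ a b) (prodSet D Y))
          (count-cartesianProduct (restrictsTo? _ _) (mapsSym? _ _) D Y)

arrayIndex : ∀ {n r} .{{_ : NonZero r}} → ℕ → List (Word n r) → ℕ
arrayIndex {r = r} t D = _/_ (length D) (r ^ t) {{m^n≢0 r t}}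

module _ {n r t : ℕ} .{{_ : NonZero r}} {D : List (Word n r)} where

  private instance
    r^t≢0 : NonZero (r ^ t)
    r^t≢0 = m^n≢0 r t

  orthogonalArray-count : IsOrthogonalArray n r t D →
    ∀ pos → Injective _≡_ _≡_ pos → ∀ w → count (restrictsTo? pos w) D ≡ arrayIndex t D
  orthogonalArray-count (_ , _ , balanced) pos pos-inj w = begin
    count (restrictsTo? pos w) D                ≡⟨ m*n/n≡m _ (r ^ t) ⟨
    count (restrictsTo? pos w) D * r ^ t / r ^ t ≡⟨ cong (_/ r ^ t) (balanced pos pos-inj w) ⟩
    arrayIndex t D                              ∎
    where open ≡-Reasoning

  orthogonalArray-index-positive : t ≤ n → IsOrthogonalArray n r t D → 0 < arrayIndex t D
  orthogonalArray-index-positive t≤n oa@(_ , nonempty , balanced) =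
    subst (0 <_) (orthogonalArray-count oa pos pos-inj w) (>-nonZero⁻¹ _ {{m*n≢0⇒m≢0 _}})
    where
    pos : Fin t → Fin n
    pos k = inject≤ k t≤n
    pos-inj : Injective _≡_ _≡_ pos
    pos-inj = inject≤-injective t≤n t≤n _ _
    w : Fin t → C r
    w _ = 0 mod r
    instance
      _ : NonZero (count (restrictsTo? pos w) D * r ^ t)
      _ = >-nonZero (subst (0 <_) (sym (balanced pos pos-inj w)) nonempty)

proposition7p1 : (r n t : ℕ) → .{{_ : NonZero r}} → .{{_ : NonZero n}} → .{{_ : NonZero t}} →
    t ≤ n → (Y : List (Sym n)) → (D : List (Word n r)) →
    IsSymDesign n t Y → IsOrthogonalArray n r t D →
    IsWreathDesign r n t (prodSet D Y)
proposition7p1 r n t t≤n Y D (Y-distinct , Y-nonempty , μ , μ>0 , Y-count) D-oa@(D-distinct , D-nonempty , _) =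
  prodSet-distinct D-distinct Y-distinct ,
  subst (0 <_) (sym (length-cartesianProduct D Y)) (*-mono-< D-nonempty Y-nonempty) ,
  arrayIndex t D * μ ,
  *-mono-< (orthogonalArray-index-positive t≤n D-oa) μ>0 ,
  λ a b a₂-inj b₂-inj → begin
    count (mapsWreath? a b) (prodSet D Y)
      ≡⟨ count-mapsWreath a b D Y ⟩
    count (restrictsTo? (proj₂ ∘ b) (shift a b)) D * count (mapsSym? (proj₂ ∘ a) (proj₂ ∘ b)) Y
      ≡⟨ cong₂ _*_ (orthogonalArray-count D-oa _ b₂-inj _) (Y-count _ _ a₂-inj b₂-inj) ⟩
    arrayIndex t D * μ
      ∎
  where open ≡-Reasoning
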